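{- Every c-lattice $(S,+,\sqcap,\cdot,\|,0,1_\sigma,1_\pi,U,\overline{1}_\pi)$ is a c-trioid, i.e. its reduct $(S,+,\cdot,\|,0,1_\sigma,1_\pi)$ satisfies, for all $x,y$: (c1) $(x\cdot 1_\pi)\|x=x$; (c2) $((x\cdot 1_\pi)\|1_\sigma)\cdot y=(x\cdot 1_\pi)\|y$; (c3) $(x\|y)\cdot 1_\pi=(x\cdot 1_\pi)\|(y\cdot 1_\pi)$; (c4) $(x\cdot y)\cdot 1_\pi=x\cdot(y\cdot 1_\pi)$; (c5) $1_\sigma\|1_\sigma=1_\sigma$; (c6) $x\cdot 1_\pi\le 1_\pi$.
   Context: A proto-trioid is $(S,+,\cdot,\|,0,1_\sigma,1_\pi)$ where $(S,+,0)$ is a join semilattice with least element $0$ (order $x\le y\iff x+y=y$); $1_\sigma\cdot x=x=x\cdot 1_\sigma$; $x\cdot y+x\cdot z\le x\cdot(y+z)$; $(x+y)\cdot z=x\cdot z+y\cdot z$; $0\cdot x=0$; $\|$ is associative and commutative with unit $1_\pi$, distributes over $+$, and $0\|x=0$. A c-lattice is a structure $(S,+,\sqcap,\cdot,\|,0,1_\sigma,1_\pi,U,\overline{1}_\pi)$ such that $(S,+,\sqcap,0,U)$ is a bounded distributive lattice with least element $0$ and greatest element $U$, $(S,+,\cdot,\|,0,1_\sigma,1_\pi)$ is a proto-trioid, and for all $x,y,z$: (cl1) $x\cdot 1_\pi+x\cdot\overline{1}_\pi=x\cdot U$; (cl2) $1_\pi\sqcap(x+\overline{1}_\pi)=x\cdot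 0$; (cl3) $x\cdot(y\|z)\le(x\cdot y)\|(x\cdot z)$; (cl4) $z\|z\le z\Rightarrow (x\|y)\cdot z=(x\cdot z)\|(y\cdot z)$; (cl5) $x\cdot(y\cdot(z\cdot 0))=(x\cdot y)\cdot(z\cdot 0)$; (cl6) $(x\cdot 0)\cdot y=x\cdot(0\cdot y)$; (cl7) $1_\sigma\|1_\sigma=1_\sigma$; (cl8) $((x\cdot 1_\pi)\|1_\sigma)\cdot y=(x\cdot 1_\pi)\|y$; (cl9) $((x\sqcap 1_\sigma)\cdot 1_\pi)\|1_\sigma=x\sqcap 1_\sigma$; (cl10) $((x\sqcap\overline{1}_\pi)\cdot 1_\pi)\|1_\sigma=1_\sigma\sqcap((x\sqcap\overline{1}_\pi)\cdot\overline{1}_\pi)$; (cl11) $((x\sqcap\overline{1}_\pi)\cdot 1_\pi)\|\overline{1}_\pi=(x\sqcap\overline{1}_\pi)\cdot\overline{1}_\pi$. -}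

module Defs where

open import Level using (Level; suc; _⊔_)
open import Relation.Binary.PropositionalEquality using (_≡_)

record CLattice {a : Level} (S : Set a) : Set a where
  infixr 6 _+_
  infixr 7 _⊓_
  infixl 9 _·_
  infixr 8 _∥_
  infix 4 _≤_
  field
    _+_ _⊓_ _·_ _∥_ : S → S → S
    𝟘 1σ 1π U 1̄π : S

  _≤_ : S → S → Set a
  x ≤ y = x + y ≡ y

  field
    +-assoc : ∀ x y z → (x + y) + z ≡ x + (y + z)
    +-comm  : ∀ x y → x + y ≡ y + x
    +-idem  : ∀ x → x + x ≡ x
    ⊓-assoc : ∀ x y z → (x ⊓ y) ⊓ z ≡ x ⊓ (y ⊓ z)
    ⊓-comm  : ∀ x y → x ⊓ y ≡ y ⊓ x
    ⊓-idem  : ∀ x → x ⊓ x ≡ x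
    absorb-+⊓ : ∀ x y → x + (x ⊓ y) ≡ x
    absorb-⊓+ : ∀ x y → x ⊓ (x + y) ≡ x
    distrib-⊓+ : ∀ x y z → x ⊓ (y + z) ≡ (x ⊓ y) + (x ⊓ z)
    +-identity : ∀ x → 𝟘 + x ≡ x
    ⊓-top      : ∀ x → x ⊓ U ≡ x
    ·-identityˡ : ∀ x → 1σ · x ≡ x
    ·-identityʳ : ∀ x → x · 1σ ≡ x
    ·-subdistribˡ : ∀ x y z → (x · y + x · z) ≤ (x · (y + z))
    ·-distribʳ : ∀ x y z → (x + y) · z ≡ x · z + y · z
    ·-zeroˡ : ∀ x → 𝟘 · x ≡ 𝟘
    ∥-assoc : ∀ x y z → (x ∥ y) ∥ z ≡ x ∥ (y ∥ z)
    ∥-comm  : ∀ x y → x ∥ y ≡ y ∥ x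
    ∥-identity : ∀ x → 1π ∥ x ≡ x
    ∥-distrib : ∀ x y z → x ∥ (y + z) ≡ x ∥ y + x ∥ z
    ∥-zero : ∀ x → 𝟘 ∥ x ≡ 𝟘
    cl1 : ∀ x → x · 1π + x · 1̄π ≡ x · U
    cl2 : ∀ x → 1π ⊓ (x + 1̄π) ≡ x · 𝟘
    cl3 : ∀ x y z → (x · (y ∥ z)) ≤ ((x · y) ∥ (x · z))
    cl4 : ∀ x y z → (z ∥ z) ≤ z → (x ∥ y) · z ≡ (x · z) ∥ (y · z)
    cl5 : ∀ x y z → x · (y · (z · 𝟘)) ≡ (x · y) · (z · 𝟘)
    cl6 : ∀ x y → (x · 𝟘) · y ≡ x · (𝟘 · y)
    cl7 : 1σ ∥ 1σ ≡ 1σ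
    cl8 : ∀ x y → ((x · 1π) ∥ 1σ) · y ≡ (x · 1π) ∥ y
    cl9 : ∀ x → ((x ⊓ 1σ) · 1π) ∥ 1σ ≡ x ⊓ 1σ
    cl10 : ∀ x → ((x ⊓ 1̄π) · 1π) ∥ 1σ ≡ 1σ ⊓ ((x ⊓ 1̄π) · 1̄π)
    cl11 : ∀ x → ((x ⊓ 1̄π) · 1π) ∥ 1̄π ≡ (x ⊓ 1̄π) · 1̄π

record IsCTrioid {a : Level} {S : Set a} (L : CLattice S) : Set a where
  open CLattice L
  field
    c1 : ∀ x → (x · 1π) ∥ x ≡ x
    c2 : ∀ x y → ((x · 1π) ∥ 1σ) · y ≡ (x · 1π) ∥ y
    c3 : ∀ x y → (x ∥ y) · 1π ≡ (x · 1π) ∥ (y · 1π)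
    c4 : ∀ x y → (x · y) · 1π ≡ x · (y · 1π)
    c5 : 1σ ∥ 1σ ≡ 1σ
    c6 : ∀ x → (x · 1π) ≤ 1π

-- Everything rests on U · 0 = 1π (cl2 at x = U, as U absorbs 1̄π).
-- With it, (c4) is cl5 at z = U, and (c6) holds because x · 1π = (x · U) · 0
-- and cl2 makes every y · 0 a meet with 1π. (c3) is cl4 at z = 1π, while
-- (c2), (c5) are cl8, cl7. For (c1), shrinking x · 1π to 1π inside cl8 bounds
-- (x · 1π) ∥ x above by x, and cl3 applied to x = x · (1π ∥ 1σ) bounds it
-- below by x.
module Submission where

open import Defs
open import Level using (Level)
open import Relation.Binary.Bundles using (Poset)
open import Relation.Binary.PropositionalEquality
  using (_≡_; refl; sym; trans; cong; cong₂; subst; isEquivalence; module ≡-Reasoning)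
import Relation.Binary.Reasoning.PartialOrder as PosetReasoning

module CLatticeProperties {a : Level} {S : Set a} (L : CLattice S) where
  open CLattice L
  open ≡-Reasoning

  ≤-reflexive : ∀ {x y} → x ≡ y → x ≤ y
  ≤-reflexive {x} refl = +-idem x

  ≤-trans : ∀ {x y z} → x ≤ y → y ≤ z → x ≤ z
  ≤-trans {x} {y} {z} x≤y y≤z = begin
    x + z        ≡⟨ cong (x +_) (sym y≤z) ⟩
    x + (y + z)  ≡⟨ sym (+-assoc x y z) ⟩
    (x + y) + z  ≡⟨ cong (_+ z) x≤y ⟩
    y + z        ≡⟨ y≤z ⟩
    z            ∎

  ≤-antisym : ∀ {x y} → x ≤ y → y ≤ x → x ≡ y
  ≤-antisym {x} {y} x≤y y≤x = trans (sym y≤x) (trans (+-comm y x) x≤y)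

  ≤-poset : Poset a a a
  ≤-poset = record
    { _≈_ = _≡_
    ; _≤_ = _≤_
    ; isPartialOrder = record
      { isPreorder = record
        { isEquivalence = isEquivalence
        ; reflexive = ≤-reflexive
        ; trans = ≤-trans
        }
      ; antisym = ≤-antisym
      }
    }

  ⊓-lowerˡ : ∀ x y → x ⊓ y ≤ x
  ⊓-lowerˡ x y = trans (+-comm (x ⊓ y) x) (absorb-+⊓ x y)

  ≤-top : ∀ x → x ≤ U
  ≤-top x = begin
    x + U        ≡⟨ cong (_+ U) (sym (⊓-top x)) ⟩
    x ⊓ U + U    ≡⟨ cong (_+ U) (⊓-comm x U) ⟩
    U ⊓ x + U    ≡⟨ ⊓-lowerˡ U x ⟩
    U            ∎

  ∥-monoˡ-≤ : ∀ {x y} z → x ≤ y → x ∥ z ≤ y ∥ z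
  ∥-monoˡ-≤ {x} {y} z x≤y = begin
    x ∥ z + y ∥ z  ≡⟨ cong₂ _+_ (∥-comm x z) (∥-comm y z) ⟩
    z ∥ x + z ∥ y  ≡⟨ sym (∥-distrib z x y) ⟩
    z ∥ (x + y)    ≡⟨ cong (z ∥_) x≤y ⟩
    z ∥ y          ≡⟨ ∥-comm z y ⟩
    y ∥ z          ∎

  ·-monoˡ-≤ : ∀ {x y} z → x ≤ y → x · z ≤ y · z
  ·-monoˡ-≤ {x} {y} z x≤y = trans (sym (·-distribʳ x y z)) (cong (_· z) x≤y)

  ·𝟘≤1π : ∀ x → x · 𝟘 ≤ 1π
  ·𝟘≤1π x = subst (_≤ 1π) (cl2 x) (⊓-lowerˡ 1π (x + 1̄π))

  U·𝟘≡1π : U · 𝟘 ≡ 1π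
  U·𝟘≡1π = begin
    U · 𝟘            ≡⟨ sym (cl2 U) ⟩
    1π ⊓ (U + 1̄π)    ≡⟨ cong (1π ⊓_) (trans (+-comm U 1̄π) (≤-top 1̄π)) ⟩
    1π ⊓ U           ≡⟨ ⊓-top 1π ⟩
    1π               ∎

  ·-assoc-1π : ∀ x y → (x · y) · 1π ≡ x · (y · 1π)
  ·-assoc-1π x y = begin
    (x · y) · 1π        ≡⟨ cong ((x · y) ·_) (sym U·𝟘≡1π) ⟩
    (x · y) · (U · 𝟘)   ≡⟨ sym (cl5 x y U) ⟩
    x · (y · (U · 𝟘))   ≡⟨ cong (λ w → x · (y · w)) U·𝟘≡1π ⟩
    x · (y · 1π)        ∎

  ·1π≡·U·𝟘 : ∀ x → x · 1π ≡ (x · U) · 𝟘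
  ·1π≡·U·𝟘 x = begin
    x · 1π             ≡⟨ cong (x ·_) (sym U·𝟘≡1π) ⟩
    x · (U · 𝟘)        ≡⟨ cong (λ w → x · (U · w)) (sym (·-zeroˡ 𝟘)) ⟩
    x · (U · (𝟘 · 𝟘))  ≡⟨ cl5 x U 𝟘 ⟩
    (x · U) · (𝟘 · 𝟘)  ≡⟨ cong ((x · U) ·_) (·-zeroˡ 𝟘) ⟩
    (x · U) · 𝟘        ∎

  ·1π≤1π : ∀ x → x · 1π ≤ 1π
  ·1π≤1π x = subst (_≤ 1π) (sym (·1π≡·U·𝟘 x)) (·𝟘≤1π (x · U))

  ∥-·-1π : ∀ x y → (x ∥ y) · 1π ≡ (x · 1π) ∥ (y · 1π)
  ∥-·-1π x y = cl4 x y 1π (≤-reflexive (∥-identity 1π))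

module CLatticeAbsorption {a : Level} {S : Set a} (L : CLattice S) where
  open CLattice L
  open CLatticeProperties L
  open PosetReasoning ≤-poset

  ·1π-∥-absorb : ∀ x → (x · 1π) ∥ x ≡ x
  ·1π-∥-absorb x = ≤-antisym upper lower
    where
    upper : (x · 1π) ∥ x ≤ x
    upper = begin
      (x · 1π) ∥ x          ≡⟨ sym (cl8 x x) ⟩
      ((x · 1π) ∥ 1σ) · x   ≤⟨ ·-monoˡ-≤ x (∥-monoˡ-≤ 1σ (·1π≤1π x)) ⟩
      (1π ∥ 1σ) · x         ≡⟨ cong (_· x) (∥-identity 1σ) ⟩
      1σ · x                ≡⟨ ·-identityˡ x ⟩
      x                     ∎

    lower : x ≤ (x · 1π) ∥ x
    lower = begin
      x                     ≡⟨ sym (·-identityʳ x) ⟩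
      x · 1σ                ≡⟨ cong (x ·_) (sym (∥-identity 1σ)) ⟩
      x · (1π ∥ 1σ)         ≤⟨ cl3 x 1π 1σ ⟩
      (x · 1π) ∥ (x · 1σ)   ≡⟨ cong ((x · 1π) ∥_) (·-identityʳ x) ⟩
      (x · 1π) ∥ x          ∎

proposition20 : {a : Level} {S : Set a} (L : CLattice S) → IsCTrioid L
proposition20 L = record
  { c1 = ·1π-∥-absorb
  ; c2 = cl8
  ; c3 = ∥-·-1π
  ; c4 = ·-assoc-1π
  ; c5 = cl7
  ; c6 = ·1π≤1π
  }
  where
  open CLattice L
  open CLatticeProperties L
  open CLatticeAbsorption L
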